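{- Let $G$ be a graph, let $v_0\in V(G)$, and let $k\ge 1$ be an integer. The map $S^{(k)}_{v_0}:\operatorname{Div}^k_+(G)\to\operatorname{Jac}(G)$ is injective if and only if $G$ is $(k+1)$-edge-connected.
   Context: A graph is a finite connected multigraph with no loop edges. For $m\ge 2$, $G$ is $m$-edge-connected if $G-W$ is connected for every set $W$ of at most $m-1$ edges (by convention, the graph with one vertex and no edges is $m$-edge-connected for all $m$). $\operatorname{Div}(G)$ is the free abelian group on $V(G)$ (divisors $D=\sum_v D(v)(v)$), $\deg(D)=\sum_v D(v)$, $D$ effective if all $D(v)\ge 0$; $\operatorname{Div}^k_+(G)$ is the set of effective divisors of degree $k$ and $\operatorname{Div}^0(G)$ the divisors of degree $0$. For $f:V(G)\to\mathbb{Z}$ the Laplacian is $\Delta(f)=\sum_v\big(\sum_{e=vw\in E_v}(f(v)-f(w))\big)(v)$, the inner sum over edges incident to $v$ with multiplicity; $\operatorname{Prin}(G)=\{\Delta(f)\}$. The Jacobian is $\operatorname{Jac}(G)=\operatorname{Div}^0(G)/\operatorname{Prin}(G)$, with $[D]$ the class of $D$. $S_{v_0}(v)=[(v)-(v_0)]$ and $S^{(k)}_{v_0}((v_1)+\cdots+(v_k))=S_{v_0}(v_1)+\cdots+S_{v_0}(v_k)$. -}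

module Defs where

open import Data.Nat as ℕ using (ℕ; zero; suc; _∸_)
open import Data.Integer as ℤ using (ℤ; +_; _+_; _-_; _*_)
open import Data.Fin using (Fin)
open import Data.Fin.Properties using (_≟_)
open import Data.Fin.Subset using (Subset; ∣_∣; Side; outside)
open import Data.List using (filterᵇ)
open import Data.Bool using (Bool; true; false)
open import Data.Vec using (Vec; lookup)
open import Data.List using (List; []; _∷_; map; allFin; foldr)
open import Data.List.Membership.Propositional using (_∈_)
open import Data.Product using (_×_; _,_; ∃)
open import Data.Sum using (_⊎_)
open import Relation.Binary.PropositionalEquality using (_≡_; _≢_)
open import Relation.Nullary.Decidable using (does)
open import Data.Bool using (if_then_else_)

EdgeList : ℕ → Set
EdgeList n = List (Fin n × Fin n)

data Reach {n : ℕ} (E : EdgeList n) : Fin n → Fin n → Set where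
  here  : ∀ {u} → Reach E u u
  step  : ∀ {u w v} → ((u , w) ∈ E ⊎ (w , u) ∈ E) → Reach E w v → Reach E u v

Connected : ∀ {n} → EdgeList n → Set
Connected {n} E = (u v : Fin n) → Reach E u v

record Graph : Set where
  field
    n         : ℕ
    m         : ℕ
    edges     : Vec (Fin n × Fin n) m
    loopless  : (i : Fin m) → let (a , b) = lookup edges i in a ≢ b

  edgeList : EdgeList n
  edgeList = map (lookup edges) (allFin m)

  field
    connected : Connected edgeList

open Graph public

isOutside : Side → Bool
isOutside outside = true
isOutside _ = false

removeEdges : (G : Graph) → Subset (m G) → EdgeList (n G)
removeEdges G W = map (lookup (edges G)) (filterᵇ (λ i → isOutside (lookup W i)) (allFin (m G)))

-- G is j-edge-connected (j ≥ 2 imposed in the statement):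
-- G − W is connected for every set W of at most j − 1 edges.
EdgeConnected : ℕ → Graph → Set
EdgeConnected j G = (W : Subset (m G)) → ∣ W ∣ ℕ.≤ j ∸ 1 → Connected (removeEdges G W)

sumℤ : List ℤ → ℤ
sumℤ = foldr _+_ (+ 0)

Div : Graph → Set
Div G = Fin (n G) → ℤ

deg : (G : Graph) → Div G → ℤ
deg G D = sumℤ (map D (allFin (n G)))

Effective : (G : Graph) → Div G → Set
Effective G D = ∀ v → ℤ.0ℤ ℤ.≤ D v

EffDeg : (G : Graph) → ℕ → Div G → Set
EffDeg G k D = Effective G D × deg G D ≡ + k

point : (G : Graph) → Fin (n G) → Div G
point G v w = if does (w ≟ v) then + 1 else + 0

-- Laplacian: Δ(f)(v) = Σ_{e = vw ∈ E_v} (f(v) − f(w)), with multiplicity.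
edgeContrib : ∀ {n} → (Fin n → ℤ) → Fin n → Fin n × Fin n → ℤ
edgeContrib f v (a , b) =
  (if does (v ≟ a) then f a - f b else + 0) + (if does (v ≟ b) then f b - f a else + 0)

Δ : (G : Graph) → (Fin (n G) → ℤ) → Div G
Δ G f v = sumℤ (map (edgeContrib f v) (edgeList G))

Principal : (G : Graph) → Div G → Set
Principal G D = ∃ λ (f : Fin (n G) → ℤ) → ∀ v → D v ≡ Δ G f v

-- Equality of classes in Jac(G) = Div^0(G)/Prin(G): [D₁] = [D₂] iff D₁ − D₂ ∈ Prin(G).
SameClass : (G : Graph) → Div G → Div G → Set
SameClass G D₁ D₂ = Principal G (λ v → D₁ v - D₂ v)

-- S^{(k)}_{v0}(D) = Σ S_{v0}(v_i) = [D − k (v0)]; here the representative divisor.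
S⁽_⁾ : (k : ℕ) → (G : Graph) → Fin (n G) → Div G → Div G
S⁽ k ⁾ G v₀ D v = D v - (+ k) * point G v₀ v

SInjective : (G : Graph) → Fin (n G) → ℕ → Set
SInjective G v₀ k = (D D' : Div G) → EffDeg G k D → EffDeg G k D' →
  SameClass G (S⁽ k ⁾ G v₀ D) (S⁽ k ⁾ G v₀ D') → ∀ v → D v ≡ D' v

{-# OPTIONS --safe #-}
module Submission where

-- Both sides are equivalent to: every vertex set A with ∅ ≠ A ≠ V(G) has more than k edges
-- leaving it (LargeCuts). For edge-connectivity: removing a cut disconnects G, and the edges
-- leaving a component of G − W all lie in W. For S⁽ᵏ⁾ the key estimate is that if f is larger
-- on A than off A, then Σ_{z ∈ A} Δf(z) is at least the number of edges leaving A.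
-- If D − D′ = Δf with D, D′ effective of degree k, that sum is also at most Σ_{z ∈ A} D(z) ≤ k;
-- so with large cuts no superlevel set of f is proper, f is constant and D = D′.
-- Conversely, if only c ≤ k edges leave A, put a chip on the end in A of each of them (resp. on
-- the end outside A) and k − c chips on v₀: the two effective divisors of degree k differ by
-- Δχ_A, hence have the same image, yet are different since Σ_{z ∈ A} Δχ_A(z) ≥ c ≥ 1.

open import Data.Bool using (Bool; true; false; if_then_else_; _xor_; not; T)
open import Data.Fin using (Fin; zero; suc)
open import Data.Fin.Properties using (_≟_)
open import Data.Fin.Subset using (Subset; ∣_∣; inside; outside)
open import Data.Fin.Subset.Properties using (p⊆q⇒∣p∣≤∣q∣; ∣p∣≤∣x∷p∣)
open import Data.Integer as ℤ using (ℤ; +_; _+_; _-_; _*_; -_; 0ℤ; 1ℤ)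
import Data.Integer.Properties as ℤ
open import Data.Integer.Solver using (module +-*-Solver)
open import Data.List as List using (List; []; _∷_; map; allFin)
open import Data.List.Properties using (map-cong; map-tabulate; map-∘)
open import Data.List.Membership.Propositional using (_∈_)
open import Data.List.Membership.Propositional.Properties using (∈-map⁺; ∈-map⁻; ∈-filter⁺; ∈-filter⁻; ∈-allFin)
open import Data.List.Relation.Unary.Any using (here; there)
open import Data.Nat as ℕ using (ℕ; zero; suc; z≤n; s≤s; _∸_; _≤_)
import Data.Nat.Properties as ℕ
open import Data.Product using (_×_; _,_; ∃; proj₂)
open import Data.Sum using (_⊎_; inj₁; inj₂; swap)
open import Data.Unit using (tt)
open import Data.Vec using (lookup; tabulate; _∷_)
open import Data.Vec.Properties using (lookup∘tabulate; tabulate-cong; []=⇒lookup; lookup⇒[]=)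
open import Function using (_∘_; id)
open import Function.Bundles using (_⇔_; mk⇔)
open import Relation.Binary.PropositionalEquality
open import Relation.Nullary using (Dec; yes; no; ¬_; contradiction)
open import Relation.Nullary.Decidable using (does; map′; _×-dec_; _⊎-dec_; T?; dec-true; dec-false)

open import Defs

open +-*-Solver using (solve; con; _:+_; _:-_; _:*_; _:=_)
open import Algebra.Properties.CommutativeSemigroup ℤ.+-commutativeSemigroup using (interchange)

private variable
  X Y : Set
  N : ℕ
  E : EdgeList N
  a b x y z : Fin N

χ : Bool → ℤ
χ b = if b then + 1 else 0ℤ

δ : Fin N → Fin N → ℤ
δ a x = χ (does (x ≟ a))

infixl 10 sumOver

sumOver : List X → (X → ℤ) → ℤ
sumOver l g = sumℤ (map g l)

syntax sumOver l (λ x → e) = ∑[ x ∈ l ] e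

∑-cong : {g h : X → ℤ} → (∀ x → g x ≡ h x) → (l : List X) → ∑[ x ∈ l ] g x ≡ ∑[ x ∈ l ] h x
∑-cong g≗h l = cong sumℤ (map-cong g≗h l)

∑-zero : {g : X → ℤ} → (∀ x → g x ≡ 0ℤ) → (l : List X) → ∑[ x ∈ l ] g x ≡ 0ℤ
∑-zero g≗0 []      = refl
∑-zero g≗0 (x ∷ l) = cong₂ _+_ (g≗0 x) (∑-zero g≗0 l)

∑-distrib-+ : (g h : X → ℤ) (l : List X) → ∑[ x ∈ l ] (g x + h x) ≡ ∑[ x ∈ l ] g x + ∑[ x ∈ l ] h x
∑-distrib-+ g h []      = refl
∑-distrib-+ g h (x ∷ l) = trans (cong (_+_ (g x + h x)) (∑-distrib-+ g h l)) (interchange (g x) (h x) _ _)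

∑-distrib-- : (g h : X → ℤ) (l : List X) → ∑[ x ∈ l ] (g x - h x) ≡ ∑[ x ∈ l ] g x - ∑[ x ∈ l ] h x
∑-distrib-- g h []      = refl
∑-distrib-- g h (x ∷ l) = trans (cong (_+_ (g x - h x)) (∑-distrib-- g h l)) (interchange-sub (g x) (h x) _ _)
  where
  interchange-sub : ∀ a b c d → (a - b) + (c - d) ≡ (a + c) - (b + d)
  interchange-sub = solve 4 (λ a b c d → (a :- b) :+ (c :- d) := (a :+ c) :- (b :+ d)) refl

∑-*ˡ : (c : ℤ) (g : X → ℤ) (l : List X) → ∑[ x ∈ l ] (c * g x) ≡ c * ∑[ x ∈ l ] g x
∑-*ˡ c g []      = sym (ℤ.*-zeroʳ c)
∑-*ˡ c g (x ∷ l) = trans (cong (_+_ (c * g x)) (∑-*ˡ c g l)) (sym (ℤ.*-distribˡ-+ c (g x) _))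

∑-mono-≤ : {g h : X → ℤ} → (∀ x → g x ℤ.≤ h x) → (l : List X) →
  ∑[ x ∈ l ] g x ℤ.≤ ∑[ x ∈ l ] h x
∑-mono-≤ g≤h []      = ℤ.≤-refl
∑-mono-≤ g≤h (x ∷ l) = ℤ.+-mono-≤ (g≤h x) (∑-mono-≤ g≤h l)

∑-nonneg : {g : X → ℤ} → (∀ x → 0ℤ ℤ.≤ g x) → (l : List X) → 0ℤ ℤ.≤ ∑[ x ∈ l ] g x
∑-nonneg 0≤g []      = ℤ.≤-refl
∑-nonneg 0≤g (x ∷ l) = ℤ.+-mono-≤ (0≤g x) (∑-nonneg 0≤g l)

∑-comm : (F : X → Y → ℤ) (l : List X) (k : List Y) →
  ∑[ x ∈ l ] ∑[ y ∈ k ] F x y ≡ ∑[ y ∈ k ] ∑[ x ∈ l ] F x y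
∑-comm F []      k = sym (∑-zero (λ _ → refl) k)
∑-comm F (x ∷ l) k = trans (cong (_+_ (∑[ y ∈ k ] F x y)) (∑-comm F l k)) (sym (∑-distrib-+ (F x) _ k))

∑-allFin-suc : (g : Fin (suc N) → ℤ) → ∑[ x ∈ allFin (suc N) ] g x ≡ g zero + ∑[ x ∈ allFin N ] g (suc x)
∑-allFin-suc g = begin
  sumℤ (map g (allFin _))                  ≡⟨ cong sumℤ (map-tabulate id g) ⟩
  g zero + sumℤ (List.tabulate (g ∘ suc))  ≡⟨ cong (λ s → g zero + sumℤ s) (map-tabulate id (g ∘ suc)) ⟨
  g zero + sumℤ (map (g ∘ suc) (allFin _)) ∎
  where open ≡-Reasoning

∑-δ : (a : Fin N) (h : Fin N → ℤ) → ∑[ x ∈ allFin N ] (if does (x ≟ a) then h x else 0ℤ) ≡ h a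
∑-δ {suc N} zero h = begin
  _                             ≡⟨ ∑-allFin-suc (λ x → if does (x ≟ zero) then h x else 0ℤ) ⟩
  h zero + ∑[ x ∈ allFin N ] 0ℤ ≡⟨ cong (_+_ (h zero)) (∑-zero (λ _ → refl) (allFin N)) ⟩
  h zero + 0ℤ                   ≡⟨ ℤ.+-identityʳ (h zero) ⟩
  h zero                        ∎
  where open ≡-Reasoning
∑-δ {suc N} (suc a) h =
  trans (∑-allFin-suc (λ x → if does (x ≟ suc a) then h x else 0ℤ))
        (trans (ℤ.+-identityˡ _) (∑-δ a (h ∘ suc)))

∑χ≡∣tabulate∣ : (P : Fin N → Bool) → ∑[ x ∈ allFin N ] χ (P x) ≡ + ∣ tabulate P ∣
∑χ≡∣tabulate∣ {zero}  P = refl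
∑χ≡∣tabulate∣ {suc N} P = begin
  _                                            ≡⟨ ∑-allFin-suc (χ ∘ P) ⟩
  χ (P zero) + ∑[ x ∈ allFin N ] χ (P (suc x)) ≡⟨ cong (_+_ (χ (P zero))) (∑χ≡∣tabulate∣ (P ∘ suc)) ⟩
  χ (P zero) + + ∣ tabulate (P ∘ suc) ∣        ≡⟨ χ+∣p∣ (P zero) (tabulate (P ∘ suc)) ⟩
  + ∣ tabulate P ∣                             ∎
  where
  open ≡-Reasoning
  χ+∣p∣ : ∀ {M} (b : Bool) (p : Subset M) → χ b + + ∣ p ∣ ≡ + ∣ b ∷ p ∣
  χ+∣p∣ true  p = refl
  χ+∣p∣ false p = refl

j<i⇒1≤i-j : {i j : ℤ} → j ℤ.< i → 1ℤ ℤ.≤ i - j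
j<i⇒1≤i-j {i} {j} j<i = subst (ℤ._≤ i - j) (cancel j) (ℤ.+-monoˡ-≤ (- j) (ℤ.i<j⇒suc[i]≤j j<i))
  where
  cancel : ∀ j → (1ℤ + j) - j ≡ 1ℤ
  cancel = solve 1 (λ j → (con 1ℤ :+ j) :- j := con 1ℤ) refl

[i+k]-[j+k]≡i-j : ∀ i j k → (i + k) - (j + k) ≡ i - j
[i+k]-[j+k]≡i-j = solve 3 (λ i j k → (i :+ k) :- (j :+ k) := i :- j) refl

[i-k]-[j-k]≡i-j : ∀ i j k → (i - k) - (j - k) ≡ i - j
[i-k]-[j-k]≡i-j = solve 3 (λ i j k → (i :- k) :- (j :- k) := i :- j) refl

χ-nonneg : (b : Bool) → 0ℤ ℤ.≤ χ b
χ-nonneg true  = ℤ.+≤+ z≤n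
χ-nonneg false = ℤ.+≤+ z≤n

χ*[i-j]≤i : (b : Bool) {i j : ℤ} → 0ℤ ℤ.≤ i → 0ℤ ℤ.≤ j → χ b * (i - j) ℤ.≤ i
χ*[i-j]≤i true  {i} {j} _ 0≤j =
  subst (ℤ._≤ i) (sym (ℤ.*-identityˡ (i - j))) (ℤ.i-j≤i i j {{ℤ.nonNegative 0≤j}})
χ*[i-j]≤i false 0≤i _         = 0≤i

Reach-trans : Reach E x y → Reach E y z → Reach E x z
Reach-trans here       r = r
Reach-trans (step e q) r = step e (Reach-trans q r)

Reach-sym : Reach E x y → Reach E y x
Reach-sym here       = here
Reach-sym (step e r) = Reach-trans (Reach-sym r) (step (swap e) here)

Reach-weaken : Reach E x y → Reach ((a , b) ∷ E) x y
Reach-weaken here              = here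
Reach-weaken (step (inj₁ e) r) = step (inj₁ (there e)) (Reach-weaken r)
Reach-weaken (step (inj₂ e) r) = step (inj₂ (there e)) (Reach-weaken r)

ReachVia : EdgeList N → Fin N → Fin N → Fin N → Fin N → Set
ReachVia E a b x y = Reach E x y ⊎ (Reach E x a × Reach E b y) ⊎ (Reach E x b × Reach E a y)

Reach-∷⁺ : ReachVia E a b x y → Reach ((a , b) ∷ E) x y
Reach-∷⁺ (inj₁ r)               = Reach-weaken r
Reach-∷⁺ (inj₂ (inj₁ (r , r′))) = Reach-trans (Reach-weaken r) (step (inj₁ (here refl)) (Reach-weaken r′))
Reach-∷⁺ (inj₂ (inj₂ (r , r′))) = Reach-trans (Reach-weaken r) (step (inj₂ (here refl)) (Reach-weaken r′))

Reach-∷⁻ : Reach ((a , b) ∷ E) x y → ReachVia E a b x y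
Reach-∷⁻ here                        = inj₁ here
Reach-∷⁻ (step (inj₁ (here refl)) r) with Reach-∷⁻ r
... | inj₁ r₁               = inj₂ (inj₁ (here , r₁))
... | inj₂ (inj₁ (r₁ , r₂)) = inj₁ (Reach-trans (Reach-sym r₁) r₂)
... | inj₂ (inj₂ (_ , r₂))  = inj₁ r₂
Reach-∷⁻ (step (inj₂ (here refl)) r) with Reach-∷⁻ r
... | inj₁ r₁               = inj₂ (inj₂ (here , r₁))
... | inj₂ (inj₁ (_ , r₂))  = inj₁ r₂
... | inj₂ (inj₂ (r₁ , r₂)) = inj₁ (Reach-trans (Reach-sym r₁) r₂)
Reach-∷⁻ (step (inj₁ (there e)) r) with Reach-∷⁻ r
... | inj₁ r₁               = inj₁ (step (inj₁ e) r₁)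
... | inj₂ (inj₁ (r₁ , r₂)) = inj₂ (inj₁ (step (inj₁ e) r₁ , r₂))
... | inj₂ (inj₂ (r₁ , r₂)) = inj₂ (inj₂ (step (inj₁ e) r₁ , r₂))
Reach-∷⁻ (step (inj₂ (there e)) r) with Reach-∷⁻ r
... | inj₁ r₁               = inj₁ (step (inj₂ e) r₁)
... | inj₂ (inj₁ (r₁ , r₂)) = inj₂ (inj₁ (step (inj₂ e) r₁ , r₂))
... | inj₂ (inj₂ (r₁ , r₂)) = inj₂ (inj₂ (step (inj₂ e) r₁ , r₂))

Reach-[] : Reach [] x y → x ≡ y
Reach-[] here               = refl
Reach-[] (step (inj₁ ()) _)
Reach-[] (step (inj₂ ()) _)

reach? : (E : EdgeList N) (x y : Fin N) → Dec (Reach E x y)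
reach? []            x y = map′ (λ { refl → here }) Reach-[] (x ≟ y)
reach? ((a , b) ∷ E) x y = map′ Reach-∷⁺ Reach-∷⁻
  (reach? E x y ⊎-dec (reach? E x a ×-dec reach? E b y) ⊎-dec (reach? E x b ×-dec reach? E a y))

component : EdgeList N → Fin N → Fin N → Bool
component E u z = does (reach? E u z)

crosses : (Fin N → Bool) → Fin N × Fin N → Bool
crosses A (a , b) = A a xor A b

component-closed : (E : EdgeList N) (u : Fin N) {a b : Fin N} → (a , b) ∈ E → crosses (component E u) (a , b) ≡ false
component-closed E u {a} {b} e with reach? E u a | reach? E u b
... | yes _ | yes _ = refl
... | no  _ | no  _ = refl
... | yes r | no ¬r = contradiction (Reach-trans r (step (inj₁ e) here)) ¬r
... | no ¬r | yes r = contradiction (Reach-trans r (step (inj₂ e) here)) ¬r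

walk-crosses : (A : Fin N → Bool) → Reach E x y → A x ≡ true → A y ≡ false →
  ∃ λ e → e ∈ E × crosses A e ≡ true
walk-crosses A here Ax Ay = contradiction (trans (sym Ax) Ay) λ ()
walk-crosses A (step {w = w} e r) Ax Ay with A w in Aw
... | true = walk-crosses A r Aw Ay
walk-crosses A (step (inj₁ e) r) Ax Ay | false = _ , e , cong₂ _xor_ Ax Aw
walk-crosses A (step (inj₂ e) r) Ax Ay | false = _ , e , cong₂ _xor_ Aw Ax

IsUpperSet : (Fin N → ℤ) → (Fin N → Bool) → Set
IsUpperSet f A = ∀ z w → A z ≡ true → A w ≡ false → f w ℤ.< f z

*-distribˡ-edgeContrib : (c : ℤ) (f : Fin N → ℤ) (z a b : Fin N) → c * edgeContrib f z (a , b) ≡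
  (if does (z ≟ a) then c * (f a - f b) else 0ℤ) + (if does (z ≟ b) then c * (f b - f a) else 0ℤ)
*-distribˡ-edgeContrib c f z a b with does (z ≟ a) | does (z ≟ b)
... | true  | true  = ℤ.*-distribˡ-+ c (f a - f b) (f b - f a)
... | true  | false = trans (cong (c *_) (ℤ.+-identityʳ (f a - f b))) (sym (ℤ.+-identityʳ _))
... | false | true  = trans (cong (c *_) (ℤ.+-identityˡ (f b - f a))) (sym (ℤ.+-identityˡ _))
... | false | false = ℤ.*-zeroʳ c

∑χ*edgeContrib : (A : Fin N → Bool) (f : Fin N → ℤ) (a b : Fin N) →
  ∑[ z ∈ allFin N ] (χ (A z) * edgeContrib f z (a , b)) ≡ χ (A a) * (f a - f b) + χ (A b) * (f b - f a)
∑χ*edgeContrib {N} A f a b = begin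
  ∑[ z ∈ allFin N ] (χ (A z) * edgeContrib f z (a , b))
    ≡⟨ ∑-cong (λ z → *-distribˡ-edgeContrib (χ (A z)) f z a b) (allFin N) ⟩
  ∑[ z ∈ allFin N ] (atA z + atB z)
    ≡⟨ ∑-distrib-+ atA atB (allFin N) ⟩
  ∑[ z ∈ allFin N ] atA z + ∑[ z ∈ allFin N ] atB z
    ≡⟨ cong₂ _+_ (∑-δ a (λ z → χ (A z) * (f a - f b))) (∑-δ b (λ z → χ (A z) * (f b - f a))) ⟩
  χ (A a) * (f a - f b) + χ (A b) * (f b - f a) ∎
  where
  open ≡-Reasoning
  atA atB : Fin N → ℤ
  atA z = if does (z ≟ a) then χ (A z) * (f a - f b) else 0ℤ
  atB z = if does (z ≟ b) then χ (A z) * (f b - f a) else 0ℤ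

atLeast : (Fin N → ℤ) → ℤ → Fin N → Bool
atLeast f t z = does (t ℤ.≤? f z)

atLeast-upper : (f : Fin N → ℤ) (t : ℤ) → IsUpperSet f (atLeast f t)
atLeast-upper f t z w Az Aw with t ℤ.≤? f z | t ℤ.≤? f w
atLeast-upper f t z w refl refl | yes t≤fz | no t≰fw = ℤ.<-≤-trans (ℤ.≰⇒> t≰fw) t≤fz

χcrosses≤ : (f : Fin N → ℤ) (A : Fin N → Bool) → IsUpperSet f A → (a b : Fin N) →
  χ (crosses A (a , b)) ℤ.≤ χ (A a) * (f a - f b) + χ (A b) * (f b - f a)
χcrosses≤ f A upper a b = bound (A a) (A b) refl refl
  where
  both : ∀ x y → 1ℤ * (x - y) + 1ℤ * (y - x) ≡ 0ℤ
  both = solve 2 (λ x y → con 1ℤ :* (x :- y) :+ con 1ℤ :* (y :- x) := con 0ℤ) refl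
  onlyFirst : ∀ x y → x - y ≡ 1ℤ * (x - y) + 0ℤ * (y - x)
  onlyFirst = solve 2 (λ x y → x :- y := con 1ℤ :* (x :- y) :+ con 0ℤ :* (y :- x)) refl
  onlySecond : ∀ x y → y - x ≡ 0ℤ * (x - y) + 1ℤ * (y - x)
  onlySecond = solve 2 (λ x y → y :- x := con 0ℤ :* (x :- y) :+ con 1ℤ :* (y :- x)) refl
  bound : (p q : Bool) → A a ≡ p → A b ≡ q → χ (p xor q) ℤ.≤ χ p * (f a - f b) + χ q * (f b - f a)
  bound true  true  _  _  = ℤ.≤-reflexive (sym (both (f a) (f b)))
  bound false false _  _  = ℤ.≤-refl
  bound true  false Aa Ab = subst (1ℤ ℤ.≤_) (onlyFirst (f a) (f b)) (j<i⇒1≤i-j (upper a b Aa Ab))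
  bound false true  Aa Ab = subst (1ℤ ℤ.≤_) (onlySecond (f a) (f b)) (j<i⇒1≤i-j (upper b a Ab Aa))

-- An edge with both ends in A, or both outside, contributes 0 to Σ_{z ∈ A} Δf(z);
-- an edge leaving A contributes f(inner end) − f(outer end) ≥ 1.
∑χcrosses≤∑χΔ : (L : EdgeList N) (f : Fin N → ℤ) (A : Fin N → Bool) → IsUpperSet f A →
  ∑[ e ∈ L ] χ (crosses A e) ℤ.≤ ∑[ z ∈ allFin N ] (χ (A z) * ∑[ e ∈ L ] edgeContrib f z e)
∑χcrosses≤∑χΔ {N} L f A upper = begin
  ∑[ e ∈ L ] χ (crosses A e)
    ≤⟨ ∑-mono-≤ (λ (a , b) → χcrosses≤ f A upper a b) L ⟩
  ∑[ (a , b) ∈ L ] (χ (A a) * (f a - f b) + χ (A b) * (f b - f a))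
    ≡⟨ ∑-cong (λ (a , b) → ∑χ*edgeContrib A f a b) L ⟨
  ∑[ e ∈ L ] ∑[ z ∈ allFin N ] (χ (A z) * edgeContrib f z e)
    ≡⟨ ∑-comm (λ z e → χ (A z) * edgeContrib f z e) (allFin N) L ⟨
  ∑[ z ∈ allFin N ] ∑[ e ∈ L ] (χ (A z) * edgeContrib f z e)
    ≡⟨ ∑-cong (λ z → ∑-*ˡ (χ (A z)) (edgeContrib f z) L) (allFin N) ⟩
  ∑[ z ∈ allFin N ] (χ (A z) * ∑[ e ∈ L ] edgeContrib f z e) ∎
  where open ℤ.≤-Reasoning

edgeContrib-flat : (f : Fin N → ℤ) (z a b : Fin N) → f a ≡ f b → edgeContrib f z (a , b) ≡ 0ℤ
edgeContrib-flat f z a b fa≡fb with does (z ≟ a) | does (z ≟ b)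
... | true  | true  = cong₂ _+_ (ℤ.i≡j⇒i-j≡0 fa≡fb) (ℤ.i≡j⇒i-j≡0 (sym fa≡fb))
... | true  | false = trans (ℤ.+-identityʳ _) (ℤ.i≡j⇒i-j≡0 fa≡fb)
... | false | true  = trans (ℤ.+-identityˡ _) (ℤ.i≡j⇒i-j≡0 (sym fa≡fb))
... | false | false = refl

cutEnd : (Fin N → Bool) → Fin N × Fin N → Fin N → ℤ
cutEnd A (a , b) x = if crosses A (a , b) then (if A a then δ a x else δ b x) else 0ℤ

crosses-not : (A : Fin N → Bool) (e : Fin N × Fin N) → crosses (not ∘ A) e ≡ crosses A e
crosses-not A (a , b) with A a | A b
... | true  | true  = refl
... | true  | false = refl
... | false | true  = refl
... | false | false = refl

cutEnd-nonneg : (A : Fin N → Bool) (e : Fin N × Fin N) (x : Fin N) → 0ℤ ℤ.≤ cutEnd A e x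
cutEnd-nonneg A (a , b) x with A a | A b
... | true  | true  = ℤ.≤-refl
... | true  | false = χ-nonneg (does (x ≟ a))
... | false | true  = χ-nonneg (does (x ≟ b))
... | false | false = ℤ.≤-refl

∑-cutEnd : (A : Fin N → Bool) (e : Fin N × Fin N) → ∑[ x ∈ allFin N ] cutEnd A e x ≡ χ (crosses A e)
∑-cutEnd {N} A (a , b) with A a | A b
... | true  | true  = ∑-zero (λ _ → refl) (allFin N)
... | true  | false = ∑-δ a (λ _ → 1ℤ)
... | false | true  = ∑-δ b (λ _ → 1ℤ)
... | false | false = ∑-zero (λ _ → refl) (allFin N)

cutEnd-complement : (A : Fin N → Bool) (e : Fin N × Fin N) (x : Fin N) →
  cutEnd A e x - cutEnd (not ∘ A) e x ≡ edgeContrib (χ ∘ A) x e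
cutEnd-complement A (a , b) x with A a | A b | does (x ≟ a) | does (x ≟ b)
... | true  | true  | true  | true  = refl
... | true  | true  | true  | false = refl
... | true  | true  | false | true  = refl
... | true  | true  | false | false = refl
... | true  | false | true  | true  = refl
... | true  | false | true  | false = refl
... | true  | false | false | true  = refl
... | true  | false | false | false = refl
... | false | true  | true  | true  = refl
... | false | true  | true  | false = refl
... | false | true  | false | true  = refl
... | false | true  | false | false = refl
... | false | false | true  | true  = refl
... | false | false | true  | false = refl
... | false | false | false | true  = refl
... | false | false | false | false = refl

lookup-inside⇒1≤∣p∣ : ∀ {M} (p : Subset M) (i : Fin M) → lookup p i ≡ inside → 1 ℕ.≤ ∣ p ∣
lookup-inside⇒1≤∣p∣ (inside ∷ p) zero    refl = s≤s z≤n
lookup-inside⇒1≤∣p∣ (x ∷ p)      (suc i) pᵢ   = ℕ.≤-trans (lookup-inside⇒1≤∣p∣ p i pᵢ) (∣p∣≤∣x∷p∣ x p)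

lookup-⊆⇒∣p∣≤∣q∣ : ∀ {M} (p q : Subset M) → (∀ i → lookup p i ≡ inside → lookup q i ≡ inside) →
  ∣ p ∣ ℕ.≤ ∣ q ∣
lookup-⊆⇒∣p∣≤∣q∣ p q p⊆q = p⊆q⇒∣p∣≤∣q∣ {p = p} λ {i} i∈p → lookup⇒[]= i q (p⊆q i ([]=⇒lookup i∈p))

module _ (G : Graph) where

  cut : (Fin (n G) → Bool) → Subset (m G)
  cut A = tabulate (λ i → crosses A (lookup (edges G) i))

  ∈cut⁺ : (A : Fin (n G) → Bool) {e : Fin (n G) × Fin (n G)} {i : Fin (m G)} →
    e ≡ lookup (edges G) i → crosses A e ≡ true → lookup (cut A) i ≡ inside
  ∈cut⁺ A {i = i} refl e-crosses = trans (lookup∘tabulate _ i) e-crosses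

  ∑χcrosses≡∣cut∣ : (A : Fin (n G) → Bool) → ∑[ e ∈ edgeList G ] χ (crosses A e) ≡ + ∣ cut A ∣
  ∑χcrosses≡∣cut∣ A = trans (cong sumℤ (sym (map-∘ (allFin (m G)))))
                            (∑χ≡∣tabulate∣ (λ i → crosses A (lookup (edges G) i)))

  ∣cut∣≤∑χΔ : (f : Fin (n G) → ℤ) (A : Fin (n G) → Bool) → IsUpperSet f A →
    + ∣ cut A ∣ ℤ.≤ ∑[ z ∈ allFin (n G) ] (χ (A z) * Δ G f z)
  ∣cut∣≤∑χΔ f A upper = begin
    + ∣ cut A ∣                               ≡⟨ ∑χcrosses≡∣cut∣ A ⟨
    ∑[ e ∈ edgeList G ] χ (crosses A e)       ≤⟨ ∑χcrosses≤∑χΔ (edgeList G) f A upper ⟩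
    ∑[ z ∈ allFin (n G) ] (χ (A z) * Δ G f z) ∎
    where open ℤ.≤-Reasoning

  ∈edgeList⁻ : {e : Fin (n G) × Fin (n G)} → e ∈ edgeList G → ∃ λ i → e ≡ lookup (edges G) i
  ∈edgeList⁻ e∈E = let i , _ , e≡eᵢ = ∈-map⁻ (lookup (edges G)) e∈E in i , e≡eᵢ

  ∈removeEdges⁺ : (W : Subset (m G)) (i : Fin (m G)) → lookup W i ≡ outside → lookup (edges G) i ∈ removeEdges G W
  ∈removeEdges⁺ W i Wᵢ = ∈-map⁺ (lookup (edges G))
    (∈-filter⁺ (λ j → T? (isOutside (lookup W j))) (∈-allFin i) (subst (T ∘ isOutside) (sym Wᵢ) tt))

  ∈removeEdges⁻ : (W : Subset (m G)) {e : Fin (n G) × Fin (n G)} → e ∈ removeEdges G W →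
    ∃ λ i → e ≡ lookup (edges G) i × lookup W i ≡ outside
  ∈removeEdges⁻ W e∈E with i , i∈kept , e≡eᵢ ← ∈-map⁻ (lookup (edges G)) e∈E =
    i , e≡eᵢ , isOutside⇒≡outside (lookup W i) (proj₂ (∈-filter⁻ kept? {xs = allFin (m G)} i∈kept))
    where
    kept? : (j : Fin (m G)) → Dec (T (isOutside (lookup W j)))
    kept? j = T? (isOutside (lookup W j))
    isOutside⇒≡outside : ∀ s → T (isOutside s) → s ≡ outside
    isOutside⇒≡outside false _ = refl

  cut-nonempty : (A : Fin (n G) → Bool) {x y : Fin (n G)} → A x ≡ true → A y ≡ false → 1 ℕ.≤ ∣ cut A ∣
  cut-nonempty A {x} {y} Ax Ay with e , e∈E , e-crosses ← walk-crosses A (connected G x y) Ax Ay =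
    let i , e≡eᵢ = ∈edgeList⁻ e∈E in
    lookup-inside⇒1≤∣p∣ (cut A) i (∈cut⁺ A e≡eᵢ e-crosses)

  removeEdges-crossing : (W : Subset (m G)) (A : Fin (n G) → Bool) {x y : Fin (n G)} →
    Reach (removeEdges G W) x y → A x ≡ true → A y ≡ false →
    ∃ λ i → lookup W i ≡ outside × lookup (cut A) i ≡ inside
  removeEdges-crossing W A walk Ax Ay with e , e∈E , e-crosses ← walk-crosses A walk Ax Ay =
    let i , e≡eᵢ , Wᵢ = ∈removeEdges⁻ W e∈E in
    i , Wᵢ , ∈cut⁺ A e≡eᵢ e-crosses

  cut-not : (A : Fin (n G) → Bool) → cut (not ∘ A) ≡ cut A
  cut-not A = tabulate-cong (λ i → crosses-not A (lookup (edges G) i))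

  cutDivisor : (Fin (n G) → Bool) → Div G
  cutDivisor A x = ∑[ e ∈ edgeList G ] cutEnd A e x

  cutDivisor-effective : (A : Fin (n G) → Bool) → Effective G (cutDivisor A)
  cutDivisor-effective A x = ∑-nonneg (λ e → cutEnd-nonneg A e x) (edgeList G)

  deg-cutDivisor : (A : Fin (n G) → Bool) → deg G (cutDivisor A) ≡ + ∣ cut A ∣
  deg-cutDivisor A = begin
    ∑[ x ∈ allFin (n G) ] ∑[ e ∈ edgeList G ] cutEnd A e x
      ≡⟨ ∑-comm (λ x e → cutEnd A e x) (allFin (n G)) (edgeList G) ⟩
    ∑[ e ∈ edgeList G ] ∑[ x ∈ allFin (n G) ] cutEnd A e x
      ≡⟨ ∑-cong (∑-cutEnd A) (edgeList G) ⟩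
    ∑[ e ∈ edgeList G ] χ (crosses A e)
      ≡⟨ ∑χcrosses≡∣cut∣ A ⟩
    + ∣ cut A ∣ ∎
    where open ≡-Reasoning

  cutDivisor-complement : (A : Fin (n G) → Bool) (x : Fin (n G)) →
    cutDivisor A x - cutDivisor (not ∘ A) x ≡ Δ G (χ ∘ A) x
  cutDivisor-complement A x = begin
    cutDivisor A x - cutDivisor (not ∘ A) x
      ≡⟨ ∑-distrib-- (λ e → cutEnd A e x) (λ e → cutEnd (not ∘ A) e x) (edgeList G) ⟨
    ∑[ e ∈ edgeList G ] (cutEnd A e x - cutEnd (not ∘ A) e x)
      ≡⟨ ∑-cong (λ e → cutEnd-complement A e x) (edgeList G) ⟩
    Δ G (χ ∘ A) x ∎
    where open ≡-Reasoning

  ∣cut∣≤deg : {D D′ : Div G} {f : Fin (n G) → ℤ} (A : Fin (n G) → Bool) →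
    Effective G D → Effective G D′ → (∀ z → D z - D′ z ≡ Δ G f z) → IsUpperSet f A →
    + ∣ cut A ∣ ℤ.≤ deg G D
  ∣cut∣≤deg {D} {D′} {f} A D≥0 D′≥0 D-D′≡Δ upper = begin
    + ∣ cut A ∣
      ≤⟨ ∣cut∣≤∑χΔ f A upper ⟩
    ∑[ z ∈ allFin (n G) ] (χ (A z) * Δ G f z)
      ≡⟨ ∑-cong (λ z → cong (χ (A z) *_) (D-D′≡Δ z)) (allFin (n G)) ⟨
    ∑[ z ∈ allFin (n G) ] (χ (A z) * (D z - D′ z))
      ≤⟨ ∑-mono-≤ (λ z → χ*[i-j]≤i (A z) (D≥0 z) (D′≥0 z)) (allFin (n G)) ⟩
    deg G D ∎
    where open ℤ.≤-Reasoning

  Δ-flat : (f : Fin (n G) → ℤ) → (∀ a b → f a ≡ f b) → (z : Fin (n G)) → Δ G f z ≡ 0ℤ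
  Δ-flat f flat z = ∑-zero (λ (a , b) → edgeContrib-flat f z a b (flat a b)) (edgeList G)

  module _ (v₀ : Fin (n G)) where

    addChips : ℕ → Div G → Div G
    addChips r D x = D x + + r * point G v₀ x

    addChips-effective : (r : ℕ) {D : Div G} → Effective G D → Effective G (addChips r D)
    addChips-effective r D≥0 x = ℤ.+-mono-≤ (D≥0 x) (r·χ≥0 (does (x ≟ v₀)))
      where
      r·χ≥0 : (b : Bool) → 0ℤ ℤ.≤ + r * χ b
      r·χ≥0 true  = subst (0ℤ ℤ.≤_) (sym (ℤ.*-identityʳ (+ r))) (ℤ.+≤+ z≤n)
      r·χ≥0 false = ℤ.≤-reflexive (sym (ℤ.*-zeroʳ (+ r)))

    deg-addChips : (r : ℕ) (D : Div G) → deg G (addChips r D) ≡ deg G D + + r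
    deg-addChips r D = begin
      ∑[ x ∈ V ] (D x + + r * point G v₀ x)       ≡⟨ ∑-distrib-+ D (λ x → + r * point G v₀ x) V ⟩
      deg G D + ∑[ x ∈ V ] (+ r * point G v₀ x)   ≡⟨ cong (_+_ (deg G D)) (∑-*ˡ (+ r) (point G v₀) V) ⟩
      deg G D + + r * ∑[ x ∈ V ] point G v₀ x     ≡⟨ cong (λ s → deg G D + + r * s) (∑-δ v₀ (λ _ → 1ℤ)) ⟩
      deg G D + + r * 1ℤ                          ≡⟨ cong (_+_ (deg G D)) (ℤ.*-identityʳ (+ r)) ⟩
      deg G D + + r                               ∎
      where
      open ≡-Reasoning
      V : List (Fin (n G))
      V = allFin (n G)

    addChips-cancel : (r : ℕ) (D D′ : Div G) (x : Fin (n G)) → addChips r D x - addChips r D′ x ≡ D x - D′ x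
    addChips-cancel r D D′ x = [i+k]-[j+k]≡i-j (D x) (D′ x) (+ r * point G v₀ x)

    S⁽⁾-cancel : (k : ℕ) (D D′ : Div G) (x : Fin (n G)) → S⁽ k ⁾ G v₀ D x - S⁽ k ⁾ G v₀ D′ x ≡ D x - D′ x
    S⁽⁾-cancel k D D′ x = [i-k]-[j-k]≡i-j (D x) (D′ x) (+ k * point G v₀ x)

LargeCuts : ℕ → Graph → Set
LargeCuts k G = (A : Fin (n G) → Bool) {x y : Fin (n G)} → A x ≡ true → A y ≡ false → k ℕ.< ∣ cut G A ∣

EdgeConnected⇒LargeCuts : (G : Graph) (k : ℕ) → EdgeConnected (suc k) G → LargeCuts k G
EdgeConnected⇒LargeCuts G k conn A {x} {y} Ax Ay = ℕ.≰⇒> λ ∣cut∣≤k →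
  let i , i∉cut , i∈cut = removeEdges-crossing G (cut G A) A (conn (cut G A) ∣cut∣≤k x y) Ax Ay in
  contradiction (trans (sym i∈cut) i∉cut) λ ()

LargeCuts⇒EdgeConnected : (G : Graph) (k : ℕ) → LargeCuts k G → EdgeConnected (suc k) G
LargeCuts⇒EdgeConnected G k large W ∣W∣≤k u v with reach? (removeEdges G W) u v
... | yes walk = walk
... | no ¬walk = contradiction (ℕ.≤-trans cut⊆W ∣W∣≤k)
                   (ℕ.<⇒≱ (large A (dec-true (reach? G-W u u) here) (dec-false (reach? G-W u v) ¬walk)))
  where
  G-W : EdgeList (n G)
  G-W = removeEdges G W
  A : Fin (n G) → Bool
  A = component G-W u
  cut⊆W : ∣ cut G A ∣ ℕ.≤ ∣ W ∣
  cut⊆W = lookup-⊆⇒∣p∣≤∣q∣ (cut G A) W cut⊆W′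
    where
    cut⊆W′ : ∀ i → lookup (cut G A) i ≡ inside → lookup W i ≡ inside
    cut⊆W′ i i∈cut with lookup W i in Wᵢ
    ... | inside  = refl
    ... | outside = contradiction (trans (sym i∈cut) i∉cut) λ ()
      where
      i∉cut : lookup (cut G A) i ≡ outside
      i∉cut = trans (lookup∘tabulate _ i) (component-closed G-W u (∈removeEdges⁺ G W i Wᵢ))

SInjective⇒LargeCuts : (G : Graph) (v₀ : Fin (n G)) (k : ℕ) → SInjective G v₀ k → LargeCuts k G
SInjective⇒LargeCuts G v₀ k inj A Ax Ay = ℕ.≰⇒> λ ∣cut∣≤k →
  ℕ.<⇒≱ (cut-nonempty G A Ax Ay) (ℤ.drop‿+≤+ (∣cut∣≤0 ∣cut∣≤k))
  where
  ∣cut∣≤0 : ∣ cut G A ∣ ℕ.≤ k → + ∣ cut G A ∣ ℤ.≤ 0ℤ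
  ∣cut∣≤0 ∣cut∣≤k = begin
    + ∣ cut G A ∣
      ≤⟨ ∣cut∣≤∑χΔ G (χ ∘ A) A χA-upper ⟩
    ∑[ z ∈ allFin (n G) ] (χ (A z) * Δ G (χ ∘ A) z)
      ≡⟨ ∑-zero (λ z → trans (cong (χ (A z) *_) (Δχ≡0 z)) (ℤ.*-zeroʳ (χ (A z)))) (allFin (n G)) ⟩
    0ℤ ∎
    where
    open ℤ.≤-Reasoning
    χA-upper : IsUpperSet (χ ∘ A) A
    χA-upper z w Az Aw = subst₂ (λ b c → χ c ℤ.< χ b) (sym Az) (sym Aw) (ℤ.+<+ (s≤s z≤n))
    r : ℕ
    r = k ∸ ∣ cut G A ∣
    D D′ : Div G
    D  = addChips G v₀ r (cutDivisor G A)
    D′ = addChips G v₀ r (cutDivisor G (not ∘ A))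
    deg≡k : (B : Fin (n G) → Bool) → cut G B ≡ cut G A → deg G (addChips G v₀ r (cutDivisor G B)) ≡ + k
    deg≡k B cutB≡cutA = begin-equality
      deg G (addChips G v₀ r (cutDivisor G B)) ≡⟨ deg-addChips G v₀ r (cutDivisor G B) ⟩
      deg G (cutDivisor G B) + + r             ≡⟨ cong (_+ + r) (deg-cutDivisor G B) ⟩
      + ∣ cut G B ∣ + + r                      ≡⟨ cong (λ c → + ∣ c ∣ + + r) cutB≡cutA ⟩
      + (∣ cut G A ∣ ℕ.+ r)                    ≡⟨ cong +_ (ℕ.m+[n∸m]≡n ∣cut∣≤k) ⟩
      + k                                      ∎
    D-D′≡Δχ : ∀ z → D z - D′ z ≡ Δ G (χ ∘ A) z
    D-D′≡Δχ z = trans (addChips-cancel G v₀ r (cutDivisor G A) (cutDivisor G (not ∘ A)) z)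
                      (cutDivisor-complement G A z)
    D≡D′ : ∀ z → D z ≡ D′ z
    D≡D′ = inj D D′
      (addChips-effective G v₀ r (cutDivisor-effective G A) , deg≡k A refl)
      (addChips-effective G v₀ r (cutDivisor-effective G (not ∘ A)) , deg≡k (not ∘ A) (cut-not G A))
      (χ ∘ A , λ z → trans (S⁽⁾-cancel G v₀ k D D′ z) (D-D′≡Δχ z))
    Δχ≡0 : ∀ z → Δ G (χ ∘ A) z ≡ 0ℤ
    Δχ≡0 z = trans (sym (D-D′≡Δχ z)) (ℤ.i≡j⇒i-j≡0 (D≡D′ z))

LargeCuts⇒SInjective : (G : Graph) (v₀ : Fin (n G)) (k : ℕ) → LargeCuts k G → SInjective G v₀ k
LargeCuts⇒SInjective G v₀ k large D D′ (D≥0 , degD) (D′≥0 , _) (f , S-S′≡Δ) v =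
  ℤ.i-j≡0⇒i≡j (D v) (D′ v) (trans (D-D′≡Δ v) (Δ-flat G f flat v))
  where
  D-D′≡Δ : ∀ z → D z - D′ z ≡ Δ G f z
  D-D′≡Δ z = trans (sym (S⁽⁾-cancel G v₀ k D D′ z)) (S-S′≡Δ z)
  no-ascent : ∀ x y → ¬ (f x ℤ.< f y)
  no-ascent x y fx<fy = ℕ.<⇒≱ (large A y∈A x∉A) (ℤ.drop‿+≤+ ∣cut∣≤k)
    where
    A : Fin (n G) → Bool
    A = atLeast f (f y)
    y∈A : A y ≡ true
    y∈A = dec-true (f y ℤ.≤? f y) ℤ.≤-refl
    x∉A : A x ≡ false
    x∉A = dec-false (f y ℤ.≤? f x) (ℤ.<⇒≱ fx<fy)
    ∣cut∣≤k : + ∣ cut G A ∣ ℤ.≤ + k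
    ∣cut∣≤k = subst (+ ∣ cut G A ∣ ℤ.≤_) degD (∣cut∣≤deg G A D≥0 D′≥0 D-D′≡Δ (atLeast-upper f (f y)))
  flat : ∀ a b → f a ≡ f b
  flat a b = ℤ.≤-antisym (ℤ.≮⇒≥ (no-ascent b a)) (ℤ.≮⇒≥ (no-ascent a b))

theorem1p5 : (G : Graph) (v₀ : Fin (n G)) (k : ℕ) → 1 ≤ k →
    (SInjective G v₀ k ⇔ EdgeConnected (suc k) G)
theorem1p5 G v₀ k _ = mk⇔
  (LargeCuts⇒EdgeConnected G k ∘ SInjective⇒LargeCuts G v₀ k)
  (LargeCuts⇒SInjective G v₀ k ∘ EdgeConnected⇒LargeCuts G k)
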